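{- Fix $G$ and $\lambda$. Let $U(\alpha)$ and $L(\alpha)$ be a subset of vertices and corresponding labeling solving $\textsc{stc-den}(\alpha)$. Let $U^*$ with labeling $L^*$ be a solution of \textsc{stc-den}, and write $\alpha^*=q(U^*,L^*;\lambda)$. If $\alpha>\alpha^*$, then $U(\alpha)=\emptyset$. If $\alpha<\alpha^*$, then $U(\alpha)\neq\emptyset$ and $q(U(\alpha),L(\alpha);\lambda)>\alpha$.
   Context: Let $G=(V,E)$ be a finite simple undirected unweighted graph. For $U\subseteq V$, $E(U)$ is the set of edges with both endpoints in $U$. A labeling $L$ assigns each edge the label strong or weak. A labeling satisfies the strong triadic closure (STC) property in $(U,E(U))$ if for all distinct $x,y,z\in U$ with $(x,y),(y,z)\in E(U)$ both labeled strong, we have $(x,z)\in E$. Let $m_s(U,L)$ and $m_w(U,L)$ be the numbers of strong and weak edges in $E(U)$. For $\lambda\in[0,1]$ and nonempty $U$, the score is $q(U,L;\lambda)=\frac{m_s(U,L)+\lambda m_w(U,L)}{|U|}$. Problem \textsc{stc-den}: find a nonempty $U\subseteq V$ and a labeling $L$ satisfying the STC property in $(U,E(U))$ maximizing $q(U,L;\lambda)$. Problem $\textsc{stc-den}(\alpha)$, for a real number $\alpha$: find a subset $U\subseteq V$ (possibly empty) and a labeling $L$ satisfying the STC property in $(U,E(U))$ maximizing $m_s(U,L)+\lambda m_w(U,L)-\alpha|U|$.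
   Formalization: The weight λ ∈ [0,1] and the number α are rational rather than real. -}

module Defs where

open import Data.Nat as ℕ using (ℕ; zero; suc)
open import Data.Integer using (+_)
open import Data.Rational using (ℚ; _+_; _*_; _-_; _/_; 0ℚ)
open import Data.Bool using (Bool; true; false; _∧_; not; if_then_else_)
open import Data.Fin using (Fin; _<?_)
open import Data.Fin.Subset using (Subset; _∈_; ∣_∣)
open import Data.Vec using (lookup)
open import Data.List using (map; allFin)
open import Data.Nat.ListAction using (sum)
open import Relation.Binary.PropositionalEquality using (_≡_)
open import Relation.Nullary using (¬_)
open import Relation.Nullary.Decidable using (⌊_⌋)

record Graph (n : ℕ) : Set where
  field
    adj   : Fin n → Fin n → Bool
    sym   : ∀ x y → adj x y ≡ adj y x
    irrefl : ∀ x → adj x x ≡ false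

open Graph public

Edge : ∀ {n} → Graph n → Fin n → Fin n → Set
Edge G x y = adj G x y ≡ true

-- A labeling: true = strong, false = weak. The label of the undirected
-- edge {x,y} is lab x y, which must agree with lab y x.
record Labeling (n : ℕ) : Set where
  field
    lab    : Fin n → Fin n → Bool
    labSym : ∀ x y → lab x y ≡ lab y x

open Labeling public

Strong : ∀ {n} → Labeling n → Fin n → Fin n → Set
Strong L x y = lab L x y ≡ true

STC : ∀ {n} → Graph n → Subset n → Labeling n → Set
STC G U L = ∀ x y z → x ∈ U → y ∈ U → z ∈ U →
  ¬ x ≡ y → ¬ y ≡ z → ¬ x ≡ z →
  Edge G x y → Edge G y z → Strong L x y → Strong L y z → Edge G x z

countPairs : ∀ {n} → (Fin n → Fin n → Bool) → ℕ
countPairs {n} P =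
  sum (map (λ x → sum (map (λ y → if ⌊ x <? y ⌋ ∧ P x y then 1 else 0) (allFin n))) (allFin n))

mStrong : ∀ {n} → Graph n → Subset n → Labeling n → ℕ
mStrong G U L = countPairs (λ x y → lookup U x ∧ lookup U y ∧ adj G x y ∧ lab L x y)

mWeak : ∀ {n} → Graph n → Subset n → Labeling n → ℕ
mWeak G U L = countPairs (λ x y → lookup U x ∧ lookup U y ∧ adj G x y ∧ not (lab L x y))

toℚ : ℕ → ℚ
toℚ k = + k / 1

-- x / k  (convention: 0 when k = 0; only used for nonempty U)
divℕ : ℚ → ℕ → ℚ
divℕ x zero = 0ℚ
divℕ x (suc k) = x * (+ 1 / suc k)

weight : ∀ {n} → Graph n → ℚ → Subset n → Labeling n → ℚ
weight G λ' U L = toℚ (mStrong G U L) + λ' * toℚ (mWeak G U L)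

score : ∀ {n} → Graph n → ℚ → Subset n → Labeling n → ℚ
score G λ' U L = divℕ (weight G λ' U L) ∣ U ∣

objective : ∀ {n} → Graph n → ℚ → ℚ → Subset n → Labeling n → ℚ
objective G λ' α U L = weight G λ' U L - α * toℚ ∣ U ∣

{-# OPTIONS --safe #-}
-- Since the empty set has objective 0, an optimal U(α) has non-negative
-- objective.  For nonempty U, the objective m_s + λ m_w - α|U| is |U| times
-- q(U,L;λ) - α, so its sign is the sign of q - α.  Above α* every nonempty
-- set has score below α, hence negative objective, so U(α) must be empty.
-- Below α* the set U* has positive objective, so U(α) has positive objective
-- too, which forces it to be nonempty with score above α.
module Submission where

open import Defs
open import Data.Nat using (ℕ)
open import Data.Rational using (ℚ; _≤_; _<_; 0ℚ; 1ℚ)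
open import Data.Fin.Subset using (Subset; Nonempty; ⊥)
open import Data.Product using (_×_)
open import Relation.Binary.PropositionalEquality using (_≡_)

open import Data.Nat as ℕ using (suc; NonZero; >-nonZero)
open import Data.Nat.Coprimality as Coprimality using (1-coprimeTo)
open import Data.Nat.ListAction using (sum)
open import Data.Integer using (+[1+_])
open import Data.Rational using (mkℚ; normalize; _+_; _*_; _-_; -_; 1/_)
open import Data.Rational.Properties
  using ( normalize-coprime; normalize-pos; normalize-nonNeg
        ; *-assoc; *-inverseˡ; *-identityʳ; *-zeroʳ
        ; +-assoc; +-inverseˡ; +-inverseʳ; +-identityˡ; +-identityʳ
        ; +-monoˡ-<; *-monoˡ-<-pos; *-cancelʳ-<-nonNeg
        ; <-irrefl; ≤-<-trans; <-≤-trans; <-respˡ-≡; <-respʳ-≡ )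
open import Data.Bool using (Bool; false; _∧_; not; if_then_else_)
open import Data.Bool.Properties using (∧-zeroʳ)
open import Data.Fin using (Fin)
open import Data.Fin.Subset using (_∈_; _⊆_; ∣_∣; ⁅_⁆)
open import Data.Fin.Subset.Properties
  using (Empty-unique; nonempty?; ∉⊥; ∣⊥∣≡0; ∣⁅x⁆∣≡1; x∈⁅y⁆⇒x≡y; p⊆q⇒∣p∣≤∣q∣)
open import Data.List using ([]; _∷_; map; allFin)
open import Data.Vec using (lookup)
open import Data.Vec.Properties using (lookup-replicate)
open import Data.Product using (_,_)
open import Relation.Binary.PropositionalEquality as ≡
  using (refl; trans; cong; cong₂; subst; module ≡-Reasoning)
open import Relation.Nullary using (yes; no)
open import Data.Empty using (⊥-elim)
open import Function using (_∘_)

p<q⇒p-q<0 : ∀ {p q} → p < q → p - q < 0ℚ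
p<q⇒p-q<0 {p} {q} p<q = <-respʳ-≡ (+-inverseʳ q) (+-monoˡ-< (- q) p<q)

q<p⇒0<p-q : ∀ {p q} → q < p → 0ℚ < p - q
q<p⇒0<p-q {p} {q} q<p = <-respˡ-≡ (+-inverseʳ q) (+-monoˡ-< (- q) q<p)

p-q+q≡p : ∀ p q → p - q + q ≡ p
p-q+q≡p p q = trans (+-assoc p (- q) q) (trans (cong (λ z → p + z) (+-inverseˡ q)) (+-identityʳ p))

0<p-q⇒q<p : ∀ {p q} → 0ℚ < p - q → q < p
0<p-q⇒q<p {p} {q} 0<p-q =
  <-respʳ-≡ (p-q+q≡p p q) (<-respˡ-≡ (+-identityˡ q) (+-monoˡ-< q 0<p-q))

divℕ-*-toℚ : ∀ w k .{{_ : NonZero k}} → divℕ w k * toℚ k ≡ w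
-- In coprime normal form, + 1 / k is definitionally the reciprocal 1/ r of toℚ k.
divℕ-*-toℚ w (suc j) = begin
  w * normalize 1 (suc j) * normalize (suc j) 1 ≡⟨ cong₂ (λ a b → w * a * b)
                                                       (normalize-coprime (1-coprimeTo (suc j)))
                                                       (normalize-coprime coprime) ⟩
  w * 1/ r * r                                  ≡⟨ *-assoc w (1/ r) r ⟩
  w * (1/ r * r)                                ≡⟨ cong (w *_) (*-inverseˡ r) ⟩
  w * 1ℚ                                        ≡⟨ *-identityʳ w ⟩
  w                                             ∎
  where
  open ≡-Reasoning
  coprime = Coprimality.sym (1-coprimeTo (suc j))
  r = mkℚ +[1+ j ] 0 coprime

module _ {w α : ℚ} (k : ℕ) .{{_ : NonZero k}} where

  private
    instance
      toℚ-pos = normalize-pos k 1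
      toℚ-nonNeg = normalize-nonNeg k 1

  divℕ<⇒<* : divℕ w k < α → w < α * toℚ k
  divℕ<⇒<* w/k<α = <-respˡ-≡ (divℕ-*-toℚ w k) (*-monoˡ-<-pos (toℚ k) w/k<α)

  <divℕ⇒*< : α < divℕ w k → α * toℚ k < w
  <divℕ⇒*< α<w/k = <-respʳ-≡ (divℕ-*-toℚ w k) (*-monoˡ-<-pos (toℚ k) α<w/k)

  *<⇒<divℕ : α * toℚ k < w → α < divℕ w k
  *<⇒<divℕ αk<w = *-cancelʳ-<-nonNeg (toℚ k) (<-respʳ-≡ (≡.sym (divℕ-*-toℚ w k)) αk<w)

sum-map-≗0 : ∀ {A : Set} (f : A → ℕ) → (∀ x → f x ≡ 0) → ∀ xs → sum (map f xs) ≡ 0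
sum-map-≗0 f f≗0 []       = refl
sum-map-≗0 f f≗0 (x ∷ xs) = cong₂ ℕ._+_ (f≗0 x) (sum-map-≗0 f f≗0 xs)

countPairs-false : ∀ {n} (P : Fin n → Fin n → Bool) → (∀ x y → P x y ≡ false) → countPairs P ≡ 0
countPairs-false {n} P P≡false =
  sum-map-≗0 _ (λ x → sum-map-≗0 _ (λ y → cong (λ b → if b then 1 else 0)
                                               (trans (cong (_ ∧_) (P≡false x y)) (∧-zeroʳ _)))
                                   (allFin n))
             (allFin n)

countPairs-⊥ : ∀ {n} (Q : Fin n → Fin n → Bool) → countPairs (λ x y → lookup (⊥ {n}) x ∧ Q x y) ≡ 0
countPairs-⊥ Q = countPairs-false _ (λ x y → cong (_∧ Q x y) (lookup-replicate x false))

objective-⊥ : ∀ {n} (G : Graph n) λ' α (L : Labeling n) → objective G λ' α ⊥ L ≡ 0ℚ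
objective-⊥ {n} G λ' α L
  rewrite countPairs-⊥ {n} (λ x y → lookup ⊥ y ∧ adj G x y ∧ lab L x y)
        | countPairs-⊥ {n} (λ x y → lookup ⊥ y ∧ adj G x y ∧ not (lab L x y))
        | ∣⊥∣≡0 n | *-zeroʳ λ' | *-zeroʳ α = refl

STC-⊥ : ∀ {n} (G : Graph n) (L : Labeling n) → STC G ⊥ L
STC-⊥ G L x y z x∈⊥ = ⊥-elim (∉⊥ x∈⊥)

Nonempty⇒NonZero∣p∣ : ∀ {n} {p : Subset n} → Nonempty p → NonZero ∣ p ∣
Nonempty⇒NonZero∣p∣ {p = p} (x , x∈p) =
  >-nonZero (subst (ℕ._≤ ∣ p ∣) (∣⁅x⁆∣≡1 x) (p⊆q⇒∣p∣≤∣q∣ ⁅x⁆⊆p))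
  where
  ⁅x⁆⊆p : ⁅ x ⁆ ⊆ p
  ⁅x⁆⊆p y∈⁅x⁆ = subst (_∈ p) (≡.sym (x∈⁅y⁆⇒x≡y x y∈⁅x⁆)) x∈p

module ObjectiveSign {n} (G : Graph n) (λ' α : ℚ) (U : Subset n) (L : Labeling n) where

  score<⇒objective<0 : Nonempty U → score G λ' U L < α → objective G λ' α U L < 0ℚ
  score<⇒objective<0 U≢∅ = p<q⇒p-q<0 ∘ divℕ<⇒<* ∣ U ∣ {{Nonempty⇒NonZero∣p∣ U≢∅}}

  <score⇒0<objective : Nonempty U → α < score G λ' U L → 0ℚ < objective G λ' α U L
  <score⇒0<objective U≢∅ = q<p⇒0<p-q ∘ <divℕ⇒*< ∣ U ∣ {{Nonempty⇒NonZero∣p∣ U≢∅}}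

  0<objective⇒Nonempty : 0ℚ < objective G λ' α U L → Nonempty U
  0<objective⇒Nonempty 0<obj with nonempty? U
  ... | yes U≢∅ = U≢∅
  ... | no  U-empty = ⊥-elim (<-irrefl refl (<-respʳ-≡ (objective-∅ (Empty-unique U-empty)) 0<obj))
    where
    objective-∅ : U ≡ ⊥ → objective G λ' α U L ≡ 0ℚ
    objective-∅ refl = objective-⊥ G λ' α L

  0<objective⇒<score : 0ℚ < objective G λ' α U L → α < score G λ' U L
  0<objective⇒<score 0<obj =
    *<⇒<divℕ ∣ U ∣ {{Nonempty⇒NonZero∣p∣ (0<objective⇒Nonempty 0<obj)}} (0<p-q⇒q<p 0<obj)

proposition5p1 : (n : ℕ) (G : Graph n) (λ' : ℚ) → 0ℚ ≤ λ' → λ' ≤ 1ℚ →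
    (α : ℚ) (Uα : Subset n) (Lα : Labeling n) →
    STC G Uα Lα →
    (∀ U L → STC G U L → objective G λ' α U L ≤ objective G λ' α Uα Lα) →
    (U* : Subset n) (L* : Labeling n) →
    Nonempty U* → STC G U* L* →
    (∀ U L → Nonempty U → STC G U L → score G λ' U L ≤ score G λ' U* L*) →
    (score G λ' U* L* < α → Uα ≡ ⊥) ×
    (α < score G λ' U* L* → Nonempty Uα × α < score G λ' Uα Lα)
proposition5p1 n G λ' _ _ α Uα Lα stcα Uα-optimal U* L* U*≢∅ stc* U*-optimal =
  empty-above , nonempty-below
  where
  open ObjectiveSign G λ' α

  0≤objα : 0ℚ ≤ objective G λ' α Uα Lα
  0≤objα = subst (_≤ objective G λ' α Uα Lα) (objective-⊥ G λ' α Lα) (Uα-optimal ⊥ Lα (STC-⊥ G Lα))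

  empty-above : score G λ' U* L* < α → Uα ≡ ⊥
  empty-above q*<α = Empty-unique λ Uα≢∅ →
    <-irrefl refl (≤-<-trans 0≤objα
      (score<⇒objective<0 Uα Lα Uα≢∅ (≤-<-trans (U*-optimal Uα Lα Uα≢∅ stcα) q*<α)))

  nonempty-below : α < score G λ' U* L* → Nonempty Uα × α < score G λ' Uα Lα
  nonempty-below α<q* = 0<objective⇒Nonempty Uα Lα 0<objα , 0<objective⇒<score Uα Lα 0<objα
    where
    0<objα : 0ℚ < objective G λ' α Uα Lα
    0<objα = <-≤-trans (<score⇒0<objective U* L* U*≢∅ α<q*) (Uα-optimal U* L* stc*)
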